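{- For every positive integer $n$, the number $\overline{p}(n)$ of overpartitions of $n$ satisfies \[ \overline{p}(n) = 2\sum_{\pi \in \mathcal{P}^{\ast}(n)} \omega(\pi), \qquad\text{where}\qquad \omega(\pi) := \nu(\ell(\pi))\prod_{i=1}^{\ell(\pi) - 1} \big(2\nu(i) - 1\big). \]
   Context: An overpartition of $n$ is a partition of $n$ in which the first occurrence of each distinct part may optionally be overlined. $\mathcal{P}^{\ast}(n)$ is the set of partitions of $n$ whose set of distinct parts is exactly $\{1,2,\dots,\ell(\pi)\}$. For a partition $\pi$, $\ell(\pi)$ is its largest part and $\nu(j)$ the number of times the integer $j$ occurs as a part of $\pi$. -}

module Defs where

open import Data.Nat using (ℕ; zero; suc; _+_; _*_; _∸_; _≤_; _≥_; _⊔_)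
open import Data.Nat.Properties using (_≟_)
open import Data.Bool using (Bool; true; false)
open import Data.Product using (_×_; _,_; proj₁)
open import Data.List using (List; []; _∷_; map; length; filter; upTo; foldr)
open import Data.Nat.ListAction using (sum; product)
open import Data.List.Relation.Unary.All using (All)
open import Data.List.Relation.Unary.Linked using (Linked)
open import Data.List.Membership.Propositional using (_∈_)
open import Relation.Binary.PropositionalEquality using (_≡_)
open import Function.Bundles using (_⇔_)
open import Data.List.Relation.Unary.Unique.Propositional using (Unique)

record IsPartition (n : ℕ) (π : List ℕ) : Set where
  field
    positive : All (λ k → 1 ≤ k) π
    nonincr  : Linked _≥_ π
    total    : sum π ≡ n

-- An overpartition: parts tagged with a Bool (true = overlined), listed in
-- non-increasing order of parts; only the first occurrence of a part may be
-- overlined (canonical form: among equal parts, an overlined copy comes first,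
-- so a part equal to its predecessor is never overlined).
OverStep : ℕ × Bool → ℕ × Bool → Set
OverStep (a , _) (b , y) = (a ≥ b) × (a ≡ b → y ≡ false)

record IsOverpartition (n : ℕ) (π : List (ℕ × Bool)) : Set where
  field
    positive : All (λ p → 1 ≤ proj₁ p) π
    ordered  : Linked OverStep π
    total    : sum (map proj₁ π) ≡ n

ν : List ℕ → ℕ → ℕ
ν π j = length (filter (j ≟_) π)

ℓ : List ℕ → ℕ
ℓ π = foldr _⊔_ 0 π

record IsPStar (n : ℕ) (π : List ℕ) : Set where
  field
    partition : IsPartition n π
    parts     : ∀ j → (j ∈ π) ⇔ ((1 ≤ j) × (j ≤ ℓ π))

-- ω(π) = ν(ℓ(π)) * ∏_{i=1}^{ℓ(π)-1} (2ν(i) - 1)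
-- (on P*(n) every ν(i) ≥ 1 for 1 ≤ i ≤ ℓ(π), so truncated subtraction is exact)
ω : List ℕ → ℕ
ω π = ν π (ℓ π) * product (map (λ i → 2 * ν π i ∸ 1) (map suc (upTo (ℓ π ∸ 1))))

record Enumerates {A : Set} (P : A → Set) (L : List A) : Set where
  field
    unique   : Unique L
    sound    : ∀ {x} → x ∈ L → P x
    complete : ∀ {x} → P x → x ∈ L

{-# OPTIONS --safe #-}
-- Both sides are compared through generating functions, a formal power series being its
-- sequence of coefficients ℕ → ℕ; division by 1 − q^k is the unique solution g of
-- g = f + q^k g.  Building a P* partition by adding its parts in decreasing order and
-- tracking how ω changes gives linear recurrences for the weighted counts; solving them,
-- twice the ω-weighted generating function of the P* partitions with largest part l is
-- q^(l(l+1)/2) (−1;q)_l / (q;q)_l².  Summed over l this is (−q;q)_∞ / (q;q)_∞, the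
-- generating function of overpartitions: coefficientwise it is the limit M → ∞ of the finite
-- identity  Σ_l q^(l(l+1)/2) [M choose l]_q c(s+l) = c(s) ∏_{i=1}^{M} (1 + q^i) / (1 − q^(s+i)),
-- where c(s) = (−1;q)_s / (q;q)_s, proved by induction on M from the q-Pascal rules.
module Submission where

open import Algebra.Bundles using (CommutativeMonoid)
import Algebra.Construct.Pointwise as Pointwise
open import Algebra.Structures using (IsCommutativeMonoid)
open import Data.Bool using (Bool; true; false)
open import Data.List using (List; []; _∷_; [_]; _++_; _∷ʳ_; map; length; upTo)
open import Data.List.Membership.Propositional using (_∈_; _∉_)
open import Data.List.Membership.Propositional.Properties
  using (∈-map⁻; ∈-map⁺; ∈-++⁻; ∈-++⁺ˡ; ∈-++⁺ʳ)
open import Data.List.Membership.Propositional.Properties.WithK using (unique∧set⇒bag)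
open import Data.List.Properties
  using ( map-∘; map-++; ∷-injectiveʳ; upTo-∷ʳ; length-++; length-map
        ; filter-accept; filter-reject; filter-none )
open import Data.List.Relation.Binary.BagAndSetEquality using (∼bag⇒↭)
open import Data.List.Relation.Binary.Permutation.Propositional using (_↭_)
open import Data.List.Relation.Binary.Permutation.Propositional.Properties using (↭-length; map⁺)
import Data.List.Relation.Unary.AllPairs as AllPairs
open import Data.List.Relation.Unary.All as All using (All; []; _∷_)
open import Data.List.Relation.Unary.Any using (here; there)
open import Data.List.Relation.Unary.Linked as Linked using (Linked; []; [-]; _∷_)
open import Data.List.Relation.Unary.Unique.Propositional using (Unique)
import Data.List.Relation.Unary.Unique.Propositional.Properties as Unique
open import Data.Nat using (ℕ; zero; suc; _+_; _*_; _∸_; _⊔_; _≤_; _<_; _≥_; z≤n; s≤s)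
open import Data.Nat.Induction using (<-rec)
open import Data.Nat.ListAction using (sum; product)
open import Data.Nat.ListAction.Properties using (sum-↭; product-++)
open import Data.Nat.Properties
  using ( _≟_; ≤-refl; ≤-trans; ≤-antisym; ≤-pred; <-trans; n<1+n; n≤1+n; m≤n⇒m≤1+n; m≤m+n
        ; m≤n+m; ≤∧≢⇒<; m≤n⇒m<n∨m≡n; <⇒≢; n≮n; 1+n≰n; 1+n≢n; suc-injective
        ; +-comm; +-assoc; +-suc; +-identityʳ; *-identityʳ; ⊔-idem; m≥n⇒m⊔n≡m
        ; +-0-isCommutativeMonoid; +-commutativeSemigroup )
open import Algebra.Properties.CommutativeSemigroup +-commutativeSemigroup
  using () renaming (interchange to +-interchange)
open import Data.Nat.Tactic.RingSolver using (solve-∀)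
open import Data.List.Membership.DecPropositional _≟_ using (_∈?_)
open import Data.Product using (_×_; _,_; proj₁; proj₂; ∃-syntax; uncurry)
open import Data.Sum using (inj₁; inj₂)
open import Function.Base using (_∘_)
open import Function.Bundles using (_⇔_; mk⇔; Equivalence)
open import Relation.Binary.Bundles using (Setoid)
open import Relation.Binary.PropositionalEquality
  using (_≡_; _≢_; _≗_; refl; sym; trans; cong; cong₂; subst; _→-setoid_; module ≡-Reasoning)
import Relation.Binary.Reasoning.Setoid as SetoidReasoning
open import Relation.Nullary using (¬_; yes; no; contradiction)

open import Defs

-- Sequences defined by causal recursion

Causal : {A : Set} → ((ℕ → A) → ℕ → A) → Set
Causal F = ∀ {g h} n → (∀ m → m < n → g m ≡ h m) → F g n ≡ F h n

module _ {A : Set} (ε : A) (F : (ℕ → A) → ℕ → A) (causal : Causal F) where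

  private
    approx : ℕ → ℕ → A
    approx zero    = F (λ _ → ε)
    approx (suc i) = F (approx i)

    approx-stable : ∀ i j n → n ≤ i → n ≤ j → approx i n ≡ approx j n
    approx-stable zero    zero    n _ _ = refl
    approx-stable zero    (suc j) 0 _ _ = causal 0 λ _ ()
    approx-stable (suc i) zero    0 _ _ = causal 0 λ _ ()
    approx-stable (suc i) (suc j) n n≤1+i n≤1+j = causal n λ m m<n →
      approx-stable i j m (≤-pred (≤-trans m<n n≤1+i)) (≤-pred (≤-trans m<n n≤1+j))

  opaque
    fix : ℕ → A
    fix n = approx n n

    fix-unfold : fix ≗ F fix
    fix-unfold zero    = causal 0 λ _ ()
    fix-unfold (suc n) = causal (suc n) λ m m<1+n →
      approx-stable n m m (≤-pred m<1+n) ≤-refl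

  fix-ind : ∀ (Φ : ℕ → A → Set) → (∀ n → (∀ m → m < n → Φ m (fix m)) → Φ n (F fix n)) →
            ∀ n → Φ n (fix n)
  fix-ind Φ step = <-rec (λ n → Φ n (fix n)) λ n ih →
    subst (Φ n) (sym (fix-unfold n)) (step n λ _ m<n → ih m<n)

  fix-unique : ∀ {g} → g ≗ F g → g ≗ fix
  fix-unique {g} g≗Fg = <-rec (λ n → g n ≡ fix n) λ n ih →
    trans (g≗Fg n) (trans (causal n λ _ m<n → ih m<n) (sym (fix-unfold n)))

delay : {A : Set} → A → ℕ → (ℕ → A) → ℕ → A
delay ε zero    g n       = g n
delay ε (suc k) g zero    = ε
delay ε (suc k) g (suc n) = delay ε k g n

module _ {A : Set} {ε : A} where

  delay-cong : ∀ k {g h : ℕ → A} → g ≗ h → delay ε k g ≗ delay ε k h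
  delay-cong zero    g≗h n       = g≗h n
  delay-cong (suc k) g≗h zero    = refl
  delay-cong (suc k) g≗h (suc n) = delay-cong k g≗h n

  delay-local : ∀ k {g h : ℕ → A} n → (∀ m → m ≤ n → g m ≡ h m) →
                delay ε k g n ≡ delay ε k h n
  delay-local zero    n       g≡h = g≡h n ≤-refl
  delay-local (suc k) zero    g≡h = refl
  delay-local (suc k) (suc n) g≡h = delay-local k n λ m m≤n → g≡h m (m≤n⇒m≤1+n m≤n)

  delay-causal : ∀ k → Causal (delay ε (suc k))
  delay-causal k zero    _   = refl
  delay-causal k (suc n) g≡h = delay-local k n λ m m≤n → g≡h m (s≤s m≤n)

  delay-delay : ∀ a b (g : ℕ → A) → delay ε a (delay ε b g) ≗ delay ε (a + b) g
  delay-delay zero    b g n       = refl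
  delay-delay (suc a) b g zero    = refl
  delay-delay (suc a) b g (suc n) = delay-delay a b g n

  delay-preserves : ∀ (P : A → Set) {g} → P ε → ∀ k n → (∀ m → k + m ≡ n → P (g m)) →
                    P (delay ε k g n)
  delay-preserves P Pε zero    n       Pg = Pg n refl
  delay-preserves P Pε (suc k) zero    Pg = Pε
  delay-preserves P Pε (suc k) (suc n) Pg = delay-preserves P Pε k n λ m k+m≡n → Pg m (cong suc k+m≡n)

delay-natural : ∀ {A B : Set} (φ : A → B) {ε} k (g : ℕ → A) →
                φ ∘ delay ε k g ≗ delay (φ ε) k (φ ∘ g)
delay-natural φ zero    g n       = refl
delay-natural φ (suc k) g zero    = refl
delay-natural φ (suc k) g (suc n) = delay-natural φ k g n

module _ {A : Set} (_∙_ : A → A → A) (b : ℕ → A) (ε : A) (k : ℕ) (φ : ℕ → A → A) where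

  private
    step : (ℕ → A) → ℕ → A
    step g n = b n ∙ delay ε (suc k) (λ m → φ m (g m)) n

    step-causal : Causal step
    step-causal n g≡h = cong (b n ∙_) (delay-causal k n λ m m<n → cong (φ m) (g≡h m m<n))

  delayedFix : ℕ → A
  delayedFix = fix ε step step-causal

  delayedFix-unfold : ∀ n → delayedFix n ≡ b n ∙ delay ε (suc k) (λ m → φ m (delayedFix m)) n
  delayedFix-unfold = fix-unfold ε step step-causal

  delayedFix-unique : ∀ {g} → (∀ n → g n ≡ b n ∙ delay ε (suc k) (λ m → φ m (g m)) n) →
                      g ≗ delayedFix
  delayedFix-unique = fix-unique ε step step-causal

  delayedFix-ind : ∀ (Φ : ℕ → A → Set) →
    (∀ n → (∀ m → m < n → Φ m (delayedFix m)) →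
           Φ n (b n ∙ delay ε (suc k) (λ m → φ m (delayedFix m)) n)) →
    ∀ n → Φ n (delayedFix n)
  delayedFix-ind = fix-ind ε step step-causal

-- Formal power series

Series : Set
Series = ℕ → ℕ

infixl 6 _⊕_
_⊕_ : Series → Series → Series
(f ⊕ g) n = f n + g n

0ₛ : Series
0ₛ _ = 0

1ₛ : Series
1ₛ zero    = 1
1ₛ (suc _) = 0

⊕-isCommutativeMonoid : IsCommutativeMonoid _≗_ _⊕_ 0ₛ
⊕-isCommutativeMonoid = Pointwise.isCommutativeMonoid ℕ +-0-isCommutativeMonoid

⊕-commutativeMonoid : CommutativeMonoid _ _
⊕-commutativeMonoid = record { isCommutativeMonoid = ⊕-isCommutativeMonoid }

open CommutativeMonoid ⊕-commutativeMonoid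
  using () renaming (∙-cong to ⊕-cong; comm to ⊕-comm; assoc to ⊕-assoc; identityʳ to ⊕-identityʳ)
open import Algebra.Properties.CommutativeSemigroup
  (CommutativeMonoid.commutativeSemigroup ⊕-commutativeMonoid)
  using (xy∙z≈x∙zy; x∙yz≈y∙xz) renaming (interchange to ⊕-interchange)

⊕-congˡ : ∀ f {g g′} → g ≗ g′ → f ⊕ g ≗ f ⊕ g′
⊕-congˡ f g≗g′ n = cong (f n +_) (g≗g′ n)

⊕-congʳ : ∀ {f f′} g → f ≗ f′ → f ⊕ g ≗ f′ ⊕ g
⊕-congʳ g f≗f′ n = cong (_+ g n) (f≗f′ n)

module ≗ = Setoid (ℕ →-setoid ℕ)
module ≗-Reasoning = SetoidReasoning (ℕ →-setoid ℕ)

-- On generating functions, `shift k f` is q^k f, `geom k f` is f / (1 − q^(1+k)) and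
-- `plusShift k f` is (1 + q^k) f.
shift : ℕ → Series → Series
shift = delay 0

shift-⊕ : ∀ k f g → shift k (f ⊕ g) ≗ shift k f ⊕ shift k g
shift-⊕ zero    f g n       = refl
shift-⊕ (suc k) f g zero    = refl
shift-⊕ (suc k) f g (suc n) = shift-⊕ k f g n

shift-0ₛ : ∀ k → shift k 0ₛ ≗ 0ₛ
shift-0ₛ k n = delay-preserves (_≡ 0) refl k n λ _ _ → refl

shift-shift : ∀ a b f → shift a (shift b f) ≗ shift (a + b) f
shift-shift = delay-delay

shift-comm : ∀ a b f → shift a (shift b f) ≗ shift b (shift a f)
shift-comm a b f n = begin
  shift a (shift b f) n ≡⟨ shift-shift a b f n ⟩
  shift (a + b) f n     ≡⟨ cong (λ k → shift k f n) (+-comm a b) ⟩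
  shift (b + a) f n     ≡⟨ shift-shift b a f n ⟨
  shift b (shift a f) n ∎
  where open ≡-Reasoning

shift-exchange : ∀ a b f → shift (suc a) (shift b f) ≗ shift (suc b) (shift a f)
shift-exchange a b f = ≗.trans (≗.sym (shift-shift 1 a (shift b f)))
  (≗.trans (delay-cong 1 (shift-comm a b f)) (shift-shift 1 b (shift a f)))

geom : ℕ → Series → Series
geom k f = delayedFix _+_ f 0 k λ _ x → x

geom-unfold : ∀ k f → geom k f ≗ f ⊕ shift (suc k) (geom k f)
geom-unfold k f = delayedFix-unfold _+_ f 0 k λ _ x → x

geom-unique : ∀ k f {g} → g ≗ f ⊕ shift (suc k) g → g ≗ geom k f
geom-unique k f = delayedFix-unique _+_ f 0 k λ _ x → x

plusShift : ℕ → Series → Series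
plusShift k f = f ⊕ shift k f

record Linear (T : Series → Series) : Set where
  field
    ≗-cong     : ∀ {f g} → f ≗ g → T f ≗ T g
    ⊕-homo     : ∀ f g → T (f ⊕ g) ≗ T f ⊕ T g
    shift-homo : ∀ k f → T (shift k f) ≗ shift k (T f)

∘-linear : ∀ {S T} → Linear S → Linear T → Linear (S ∘ T)
∘-linear S-lin T-lin = record
  { ≗-cong     = λ f≗g → S.≗-cong (T.≗-cong f≗g)
  ; ⊕-homo     = λ f g → ≗.trans (S.≗-cong (T.⊕-homo f g)) (S.⊕-homo _ _)
  ; shift-homo = λ k f → ≗.trans (S.≗-cong (T.shift-homo k f)) (S.shift-homo k _)
  }
  where
  module S = Linear S-lin
  module T = Linear T-lin

shift-linear : ∀ k → Linear (shift k)
shift-linear k = record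
  { ≗-cong = delay-cong k ; ⊕-homo = shift-⊕ k ; shift-homo = λ j f → shift-comm k j f }

module _ {T} (T-lin : Linear T) where
  private module T = Linear T-lin

  geom-commute : ∀ k f → T (geom k f) ≗ geom k (T f)
  geom-commute k f = geom-unique k (T f) (begin
    T (geom k f)                        ≈⟨ T.≗-cong (geom-unfold k f) ⟩
    T (f ⊕ shift (suc k) (geom k f))    ≈⟨ T.⊕-homo f _ ⟩
    T f ⊕ T (shift (suc k) (geom k f))  ≈⟨ ⊕-congˡ (T f) (T.shift-homo (suc k) _) ⟩
    T f ⊕ shift (suc k) (T (geom k f))  ∎)
    where open ≗-Reasoning

  plusShift-commute : ∀ k f → T (plusShift k f) ≗ plusShift k (T f)
  plusShift-commute k f = ≗.trans (T.⊕-homo f _) (⊕-congˡ (T f) (T.shift-homo k f))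

geom-linear : ∀ k → Linear (geom k)
geom-linear k = record
  { ≗-cong     = λ {f} {g} f≗g → geom-unique k g
                   (≗.trans (geom-unfold k f) (⊕-congʳ _ f≗g))
  ; ⊕-homo     = λ f g → ≗.sym (geom-unique k (f ⊕ g) (begin
                   geom k f ⊕ geom k g
                     ≈⟨ ⊕-cong (geom-unfold k f) (geom-unfold k g) ⟩
                   (f ⊕ shift (suc k) (geom k f)) ⊕ (g ⊕ shift (suc k) (geom k g))
                     ≈⟨ ⊕-interchange f _ g _ ⟩
                   (f ⊕ g) ⊕ (shift (suc k) (geom k f) ⊕ shift (suc k) (geom k g))
                     ≈⟨ ⊕-congˡ (f ⊕ g) (shift-⊕ (suc k) _ _) ⟨
                   (f ⊕ g) ⊕ shift (suc k) (geom k f ⊕ geom k g) ∎))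
  ; shift-homo = λ j f → ≗.sym (geom-commute (shift-linear j) k f)
  }
  where open ≗-Reasoning

plusShift-linear : ∀ k → Linear (plusShift k)
plusShift-linear k = record
  { ≗-cong     = λ f≗g → ⊕-cong f≗g (delay-cong k f≗g)
  ; ⊕-homo     = λ f g → ≗.trans (⊕-congˡ (f ⊕ g) (shift-⊕ k f g)) (⊕-interchange f g _ _)
  ; shift-homo = λ j f → ≗.sym (plusShift-commute (shift-linear j) k f)
  }

id-linear : Linear (λ f → f)
id-linear = record
  { ≗-cong = λ f≗g → f≗g ; ⊕-homo = λ _ _ → ≗.refl ; shift-homo = λ _ _ → ≗.refl }

-- The q-series identity

-- c s = (−1;q)_s / (q;q)_s
c : ℕ → Series
c zero    = 1ₛ
c (suc s) = geom s (plusShift s (c s))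

-- G M s = c s · ∏_{i=1}^{M} (1 + q^i) / (1 − q^(s+i))
G : ℕ → ℕ → Series
G zero    s = c s
G (suc M) s = plusShift (suc M) (geom (M + s) (G M s))

G-sucʳ : ∀ M s → G M (suc s) ≗ plusShift s (geom (M + s) (G M s))
G-sucʳ zero    s = plusShift-commute (geom-linear s) s (c s)
G-sucʳ (suc M) s rewrite +-suc M s = begin
  plusShift (suc M) (geom (suc (M + s)) (G M (suc s)))
    ≈⟨ Linear.≗-cong plusShift∘geom (G-sucʳ M s) ⟩
  plusShift (suc M) (geom (suc (M + s)) (plusShift s Y))
    ≈⟨ Linear.≗-cong (plusShift-linear (suc M)) (plusShift-commute (geom-linear _) s Y) ⟩
  plusShift (suc M) (plusShift s (geom (suc (M + s)) Y))
    ≈⟨ plusShift-commute (plusShift-linear (suc M)) s _ ⟩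
  plusShift s (plusShift (suc M) (geom (suc (M + s)) Y))
    ≈⟨ Linear.≗-cong (plusShift-linear s) (geom-commute (plusShift-linear (suc M)) _ Y) ⟩
  plusShift s (geom (suc (M + s)) (plusShift (suc M) Y)) ∎
  where
  open ≗-Reasoning
  Y = geom (M + s) (G M s)
  plusShift∘geom = ∘-linear (plusShift-linear (suc M)) (geom-linear (suc (M + s)))

G-sucˡ : ∀ M s → G (suc M) s ≗ G M s ⊕ shift (suc M) (G M (suc s))
G-sucˡ M s = begin
  Y ⊕ shift (suc M) Y
    ≈⟨ ⊕-congʳ (shift (suc M) Y) (geom-unfold (M + s) (G M s)) ⟩
  (G M s ⊕ shift (suc M + s) Y) ⊕ shift (suc M) Y
    ≈⟨ xy∙z≈x∙zy (G M s) _ _ ⟩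
  G M s ⊕ (shift (suc M) Y ⊕ shift (suc M + s) Y)
    ≈⟨ ⊕-congˡ (G M s) (⊕-congˡ (shift (suc M) Y) (shift-shift (suc M) s Y)) ⟨
  G M s ⊕ (shift (suc M) Y ⊕ shift (suc M) (shift s Y))
    ≈⟨ ⊕-congˡ (G M s) (shift-⊕ (suc M) Y _) ⟨
  G M s ⊕ shift (suc M) (plusShift s Y)
    ≈⟨ ⊕-congˡ (G M s) (delay-cong (suc M) (G-sucʳ M s)) ⟨
  G M s ⊕ shift (suc M) (G M (suc s)) ∎
  where
  open ≗-Reasoning
  Y = geom (M + s) (G M s)

sumBelow : ℕ → (ℕ → Series) → Series
sumBelow zero    h = 0ₛ
sumBelow (suc K) h = h 0 ⊕ sumBelow K (h ∘ suc)

sumBelow-cong : ∀ K h h′ n → (∀ l → h l n ≡ h′ l n) → sumBelow K h n ≡ sumBelow K h′ n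
sumBelow-cong zero    h h′ n h≡h′ = refl
sumBelow-cong (suc K) h h′ n h≡h′ =
  cong₂ _+_ (h≡h′ 0) (sumBelow-cong K (h ∘ suc) (h′ ∘ suc) n (h≡h′ ∘ suc))

sumBelow-⊕ : ∀ K h h′ → sumBelow K (λ l → h l ⊕ h′ l) ≗ sumBelow K h ⊕ sumBelow K h′
sumBelow-⊕ zero    h h′ = ≗.refl
sumBelow-⊕ (suc K) h h′ = ≗.trans (⊕-congˡ (h 0 ⊕ h′ 0) (sumBelow-⊕ K (h ∘ suc) (h′ ∘ suc)))
                                  (⊕-interchange (h 0) (h′ 0) _ _)

sumBelow-shift : ∀ K k h → sumBelow K (shift k ∘ h) ≗ shift k (sumBelow K h)
sumBelow-shift zero    k h = ≗.sym (shift-0ₛ k)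
sumBelow-shift (suc K) k h = ≗.trans (⊕-congˡ (shift k (h 0)) (sumBelow-shift K k (h ∘ suc)))
                                     (≗.sym (shift-⊕ k (h 0) _))

sumBelow-last : ∀ K h → sumBelow (suc K) h ≗ sumBelow K h ⊕ h K
sumBelow-last zero    h = ⊕-comm (h 0) 0ₛ
sumBelow-last (suc K) h = ≗.trans (⊕-congˡ (h 0) (sumBelow-last K (h ∘ suc)))
                                  (≗.sym (⊕-assoc (h 0) _ _))

-- qBinom M l f = q^(l(l+1)/2) [M choose l]_q f
qBinom : ℕ → ℕ → Series → Series
qBinom M       zero    f = f
qBinom zero    (suc l) f = 0ₛ
qBinom (suc M) (suc l) f = qBinom M (suc l) f ⊕ shift (suc M) (qBinom M l f)

qBinom-vanish : ∀ M l f → M ≤ l → qBinom M (suc l) f ≗ 0ₛ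
qBinom-vanish zero    l       f _         = ≗.refl
qBinom-vanish (suc M) (suc l) f (s≤s M≤l) = ⊕-cong (qBinom-vanish M (suc l) f (m≤n⇒m≤1+n M≤l))
  (≗.trans (delay-cong (suc M) (qBinom-vanish M l f M≤l)) (shift-0ₛ (suc M)))

qBinom-sum : ∀ M s → sumBelow (suc M) (λ l → qBinom M l (c (s + l))) ≗ G M s
qBinom-sum zero    s n = trans (+-identityʳ _) (cong (λ k → c k n) (+-identityʳ s))
qBinom-sum (suc M) s = begin
  c (s + 0) ⊕ sumBelow (suc M) (λ l → X l ⊕ Y l)
    ≈⟨ ⊕-congˡ (c (s + 0)) (sumBelow-⊕ (suc M) X Y) ⟩
  c (s + 0) ⊕ (sumBelow (suc M) X ⊕ sumBelow (suc M) Y)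
    ≈⟨ ⊕-assoc (c (s + 0)) _ _ ⟨
  (c (s + 0) ⊕ sumBelow (suc M) X) ⊕ sumBelow (suc M) Y
    ≈⟨ ⊕-cong lower upper ⟩
  G M s ⊕ shift (suc M) (G M (suc s))
    ≈⟨ G-sucˡ M s ⟨
  G (suc M) s ∎
  where
  open ≗-Reasoning
  X Y : ℕ → Series
  X l = qBinom M (suc l) (c (s + suc l))
  Y l = shift (suc M) (qBinom M l (c (s + suc l)))
  lower : c (s + 0) ⊕ sumBelow (suc M) X ≗ G M s
  lower = begin
    c (s + 0) ⊕ sumBelow (suc M) X
      ≈⟨ ⊕-congˡ (c (s + 0)) (sumBelow-last M X) ⟩
    c (s + 0) ⊕ (sumBelow M X ⊕ X M)
      ≈⟨ ⊕-congˡ (c (s + 0)) (⊕-congˡ (sumBelow M X) (qBinom-vanish M M _ ≤-refl)) ⟩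
    c (s + 0) ⊕ (sumBelow M X ⊕ 0ₛ)
      ≈⟨ ⊕-congˡ (c (s + 0)) (⊕-identityʳ (sumBelow M X)) ⟩
    c (s + 0) ⊕ sumBelow M X
      ≈⟨ qBinom-sum M s ⟩
    G M s ∎
  upper : sumBelow (suc M) Y ≗ shift (suc M) (G M (suc s))
  upper = begin
    sumBelow (suc M) Y                              ≈⟨ sumBelow-shift (suc M) (suc M) Z ⟩
    shift (suc M) (sumBelow (suc M) Z)              ≈⟨ delay-cong (suc M) reindex ⟩
    shift (suc M) (sumBelow (suc M) Z′)             ≈⟨ delay-cong (suc M) (qBinom-sum M (suc s)) ⟩
    shift (suc M) (G M (suc s))                     ∎
    where
    Z Z′ : ℕ → Series
    Z  l = qBinom M l (c (s + suc l))
    Z′ l = qBinom M l (c (suc s + l))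
    reindex : sumBelow (suc M) Z ≗ sumBelow (suc M) Z′
    reindex n = sumBelow-cong (suc M) Z Z′ n λ l → cong (λ k → qBinom M l (c k) n) (+-suc s l)

-- eulerTerm l f = q^(l(l+1)/2) / (q;q)_l · f
eulerTerm : ℕ → Series → Series
eulerTerm zero    f = f
eulerTerm (suc l) f = shift (suc l) (geom l (eulerTerm l f))

eulerTerm-linear : ∀ l → Linear (eulerTerm l)
eulerTerm-linear zero    = id-linear
eulerTerm-linear (suc l) =
  ∘-linear (shift-linear (suc l)) (∘-linear (geom-linear l) (eulerTerm-linear l))

eulerTerm-unfold : ∀ l f → eulerTerm (suc l) f ≗ shift (suc l) (eulerTerm (suc l) f ⊕ eulerTerm l f)
eulerTerm-unfold l f = delay-cong (suc l)
  (≗.trans (geom-unfold l (eulerTerm l f)) (⊕-comm (eulerTerm l f) _))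

-- The second q-Pascal rule; `qBinom-exchange` is the step of its induction on M.
mutual
  qBinom-pascal′ : ∀ M l f →
    qBinom (suc M) (suc l) f ≗ shift (suc l) (qBinom M (suc l) f ⊕ qBinom M l f)
  qBinom-pascal′ zero zero    f zero    = refl
  qBinom-pascal′ zero zero    f (suc n) = refl
  qBinom-pascal′ zero (suc l) f n       = trans (shift-0ₛ 1 n) (sym (shift-0ₛ (2 + l) n))
  qBinom-pascal′ (suc M) l f = begin
    B′ (suc l) ⊕ shift (2 + M) (B′ l)
      ≈⟨ ⊕-congʳ (shift (2 + M) (B′ l)) (qBinom-pascal′ M l f) ⟩
    shift (suc l) (B (suc l) ⊕ B l) ⊕ shift (2 + M) (B′ l)
      ≈⟨ ⊕-congʳ (shift (2 + M) (B′ l)) (shift-⊕ (suc l) (B (suc l)) (B l)) ⟩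
    (shift (suc l) (B (suc l)) ⊕ shift (suc l) (B l)) ⊕ shift (2 + M) (B′ l)
      ≈⟨ ⊕-assoc (shift (suc l) (B (suc l))) _ _ ⟩
    shift (suc l) (B (suc l)) ⊕ (shift (suc l) (B l) ⊕ shift (2 + M) (B′ l))
      ≈⟨ ⊕-congˡ (shift (suc l) (B (suc l))) (qBinom-exchange M l f) ⟩
    shift (suc l) (B (suc l)) ⊕ (shift (suc l) (shift (suc M) (B l)) ⊕ shift (suc l) (B′ l))
      ≈⟨ ⊕-assoc (shift (suc l) (B (suc l))) _ _ ⟨
    (shift (suc l) (B (suc l)) ⊕ shift (suc l) (shift (suc M) (B l))) ⊕ shift (suc l) (B′ l)
      ≈⟨ ⊕-congʳ (shift (suc l) (B′ l)) (shift-⊕ (suc l) (B (suc l)) _) ⟨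
    shift (suc l) (B′ (suc l)) ⊕ shift (suc l) (B′ l)
      ≈⟨ shift-⊕ (suc l) (B′ (suc l)) (B′ l) ⟨
    shift (suc l) (B′ (suc l) ⊕ B′ l) ∎
    where
    open ≗-Reasoning
    B B′ : ℕ → Series
    B  j = qBinom M j f
    B′ j = qBinom (suc M) j f

  qBinom-exchange : ∀ M l f →
    shift (suc l) (qBinom M l f) ⊕ shift (2 + M) (qBinom (suc M) l f) ≗
    shift (suc l) (shift (suc M) (qBinom M l f)) ⊕ shift (suc l) (qBinom (suc M) l f)
  qBinom-exchange M zero f = ≗.trans (⊕-congˡ (shift 1 f) (≗.sym (shift-shift 1 (suc M) f)))
                                     (⊕-comm (shift 1 f) _)
  qBinom-exchange M (suc l) f = begin
    shift (2 + l) X ⊕ shift (2 + M) (X ⊕ shift (suc M) Z)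
      ≈⟨ ⊕-congˡ (shift (2 + l) X) (delay-cong (2 + M) (qBinom-pascal′ M l f)) ⟩
    shift (2 + l) X ⊕ shift (2 + M) (shift (suc l) (X ⊕ Z))
      ≈⟨ ⊕-congˡ (shift (2 + l) X) (shift-exchange (suc M) (suc l) (X ⊕ Z)) ⟩
    shift (2 + l) X ⊕ shift (2 + l) (shift (suc M) (X ⊕ Z))
      ≈⟨ shift-⊕ (2 + l) X _ ⟨
    shift (2 + l) (X ⊕ shift (suc M) (X ⊕ Z))
      ≈⟨ delay-cong (2 + l) (⊕-congˡ X (shift-⊕ (suc M) X Z)) ⟩
    shift (2 + l) (X ⊕ (shift (suc M) X ⊕ shift (suc M) Z))
      ≈⟨ delay-cong (2 + l) (x∙yz≈y∙xz X (shift (suc M) X) (shift (suc M) Z)) ⟩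
    shift (2 + l) (shift (suc M) X ⊕ (X ⊕ shift (suc M) Z))
      ≈⟨ shift-⊕ (2 + l) (shift (suc M) X) _ ⟩
    shift (2 + l) (shift (suc M) X) ⊕ shift (2 + l) (X ⊕ shift (suc M) Z) ∎
    where
    open ≗-Reasoning
    X = qBinom M (suc l) f
    Z = qBinom M l f

qBinom-stable : ∀ M l f n → n ≤ M → qBinom M l f n ≡ eulerTerm l f n
qBinom-stable M       zero    f n    _     = refl
qBinom-stable zero    (suc l) f zero _     = refl
qBinom-stable (suc M) (suc l) f n    n≤1+M = begin
  qBinom (suc M) (suc l) f n                                ≡⟨ qBinom-pascal′ M l f n ⟩
  shift (suc l) (qBinom M (suc l) f ⊕ qBinom M l f) n        ≡⟨ delay-causal l n stable-below ⟩
  shift (suc l) (eulerTerm (suc l) f ⊕ eulerTerm l f) n      ≡⟨ eulerTerm-unfold l f n ⟨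
  eulerTerm (suc l) f n                                      ∎
  where
  open ≡-Reasoning
  stable-below : ∀ m → m < n →
                 (qBinom M (suc l) f ⊕ qBinom M l f) m ≡ (eulerTerm (suc l) f ⊕ eulerTerm l f) m
  stable-below m m<n = cong₂ _+_ (qBinom-stable M (suc l) f m m≤M) (qBinom-stable M l f m m≤M)
    where m≤M = ≤-pred (≤-trans m<n n≤1+M)

overpartitionGF-eulerTerms : ∀ n →
  G (suc n) 0 (suc n) ≡ sumBelow (suc n) (λ l → eulerTerm (suc l) (c (suc l))) (suc n)
overpartitionGF-eulerTerms n = begin
  G (suc n) 0 (suc n)           ≡⟨ qBinom-sum (suc n) 0 (suc n) ⟨
  sumBelow (suc n) B (suc n)    ≡⟨ sumBelow-cong (suc n) B E (suc n) stable ⟩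
  sumBelow (suc n) E (suc n)    ∎
  where
  open ≡-Reasoning
  B E : ℕ → Series
  B l = qBinom (suc n) (suc l) (c (suc l))
  E l = eulerTerm (suc l) (c (suc l))
  stable : ∀ l → B l (suc n) ≡ E l (suc n)
  stable l = qBinom-stable (suc n) (suc l) (c (suc l)) (suc n) ≤-refl

Enumerates-↭ : ∀ {A : Set} {P : A → Set} {xs ys} → Enumerates P xs → Enumerates P ys → xs ↭ ys
Enumerates-↭ exs eys = ∼bag⇒↭ (unique∧set⇒bag X.unique Y.unique
  (mk⇔ (Y.complete ∘ X.sound) (X.complete ∘ Y.sound)))
  where
  module X = Enumerates exs
  module Y = Enumerates eys

module _ {A : Set} where

  ∈-delay⁻ : ∀ k n (g : ℕ → List A) {x} → x ∈ delay [] k g n → ∃[ m ] k + m ≡ n × x ∈ g m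
  ∈-delay⁻ zero    n       g x∈ = n , refl , x∈
  ∈-delay⁻ (suc k) (suc n) g x∈ with ∈-delay⁻ k n g x∈
  ... | m , k+m≡n , x∈gm = m , cong suc k+m≡n , x∈gm

  ∈-delay⁺ : ∀ k m (g : ℕ → List A) {x} → x ∈ g m → x ∈ delay [] k g (k + m)
  ∈-delay⁺ zero    m g x∈ = x∈
  ∈-delay⁺ (suc k) m g x∈ = ∈-delay⁺ k m g x∈

  map-∷-unique : ∀ a {xss : List (List A)} → Unique xss → Unique (map (a ∷_) xss)
  map-∷-unique a = Unique.map⁺ ∷-injectiveʳ

  sum-map-++ : ∀ (w : A → ℕ) xs ys → sum (map w (xs ++ ys)) ≡ sum (map w xs) + sum (map w ys)
  sum-map-++ w []       ys = refl
  sum-map-++ w (x ∷ xs) ys = trans (cong (w x +_) (sum-map-++ w xs ys)) (sym (+-assoc (w x) _ _))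

  sum-map-+ : ∀ (u v : A → ℕ) xs → sum (map (λ x → u x + v x) xs) ≡ sum (map u xs) + sum (map v xs)
  sum-map-+ u v []       = refl
  sum-map-+ u v (x ∷ xs) = trans (cong (u x + v x +_) (sum-map-+ u v xs))
                                 (+-interchange (u x) (v x) _ _)

  sum-map-cong : ∀ {u v : A → ℕ} {xs} → All (λ x → u x ≡ v x) xs → sum (map u xs) ≡ sum (map v xs)
  sum-map-cong []          = refl
  sum-map-cong (ux≡vx ∷ p) = cong₂ _+_ ux≡vx (sum-map-cong p)

suc+≡⇒< : ∀ {k m n} → suc k + m ≡ n → m < n
suc+≡⇒< {k} {m} refl = s≤s (m≤n+m m k)

-- Partitions in P*

data Gapless : ℕ → List ℕ → Set where
  empty  : Gapless 0 []
  fresh  : ∀ {l x} → Gapless l x → Gapless (suc l) (suc l ∷ x)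
  repeat : ∀ {l x} → Gapless (suc l) x → Gapless (suc l) (suc l ∷ x)

Gapless-≤ : ∀ {l x} → Gapless l x → All (_≤ l) x
Gapless-≤ empty      = []
Gapless-≤ (fresh g)  = ≤-refl ∷ All.map m≤n⇒m≤1+n (Gapless-≤ g)
Gapless-≤ (repeat g) = ≤-refl ∷ Gapless-≤ g

Gapless-positive : ∀ {l x} → Gapless l x → All (1 ≤_) x
Gapless-positive empty      = []
Gapless-positive (fresh g)  = s≤s z≤n ∷ Gapless-positive g
Gapless-positive (repeat g) = s≤s z≤n ∷ Gapless-positive g

Gapless-ℓ : ∀ {l x} → Gapless l x → ℓ x ≡ l
Gapless-ℓ empty                = refl
Gapless-ℓ (fresh {l} g)  = trans (cong (suc l ⊔_) (Gapless-ℓ g)) (m≥n⇒m⊔n≡m (n≤1+n l))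
Gapless-ℓ (repeat {l} g) = trans (cong (suc l ⊔_) (Gapless-ℓ g)) (⊔-idem (suc l))

∷-nonincreasing : ∀ {a x} → All (_≤ a) x → Linked _≥_ x → Linked _≥_ (a ∷ x)
∷-nonincreasing []        _  = [-]
∷-nonincreasing (b≤a ∷ _) lk = b≤a ∷ lk

Gapless-nonincreasing : ∀ {l x} → Gapless l x → Linked _≥_ x
Gapless-nonincreasing empty      = []
Gapless-nonincreasing (fresh g)  =
  ∷-nonincreasing (All.map m≤n⇒m≤1+n (Gapless-≤ g)) (Gapless-nonincreasing g)
Gapless-nonincreasing (repeat g) = ∷-nonincreasing (Gapless-≤ g) (Gapless-nonincreasing g)

Gapless-∋ : ∀ {l x j} → Gapless l x → 1 ≤ j → j ≤ l → j ∈ x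
Gapless-∋ empty      1≤j j≤0   = contradiction (≤-trans 1≤j j≤0) λ ()
Gapless-∋ (fresh g)  1≤j j≤1+l with m≤n⇒m<n∨m≡n j≤1+l
... | inj₁ j<1+l = there (Gapless-∋ g 1≤j (≤-pred j<1+l))
... | inj₂ refl  = here refl
Gapless-∋ (repeat g) 1≤j j≤1+l = there (Gapless-∋ g 1≤j j≤1+l)

Gapless-parts : ∀ {l x} → Gapless l x → ∀ j → j ∈ x ⇔ (1 ≤ j × j ≤ l)
Gapless-parts g j = mk⇔ (λ j∈x → All.lookup (Gapless-positive g) j∈x , All.lookup (Gapless-≤ g) j∈x)
                        (uncurry (Gapless-∋ g))

Gapless⇒IsPStar : ∀ {l x} → Gapless l x → IsPStar (sum x) x
Gapless⇒IsPStar {x = x} g = record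
  { partition = record
      { positive = Gapless-positive g ; nonincr = Gapless-nonincreasing g ; total = refl }
  ; parts     = λ j → subst (λ t → j ∈ x ⇔ (1 ≤ j × j ≤ t)) (sym (Gapless-ℓ g)) (Gapless-parts g j)
  }

Linked-head-bound : ∀ {A : Set} {R : A → A → Set} (key : A → ℕ) → (∀ {p q} → R p q → key q ≤ key p) →
                    ∀ {a y} → Linked R (a ∷ y) → All (λ q → key q ≤ key a) y
Linked-head-bound key R⇒≥ {y = []}    _          = []
Linked-head-bound key R⇒≥ {y = _ ∷ _} (Rab ∷ lk) =
  R⇒≥ Rab ∷ All.map (λ kc≤kb → ≤-trans kc≤kb (R⇒≥ Rab)) (Linked-head-bound key R⇒≥ lk)

module _ {a y m} (lk : Linked _≥_ (a ∷ y)) (parts : ∀ j → j ∈ a ∷ y ⇔ (1 ≤ j × j ≤ m)) where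

  head-is-max : m ≡ a
  head-is-max = ≤-antisym (All.lookup (≤-refl ∷ Linked-head-bound (λ i → i) (λ b≤a → b≤a) lk) m∈) a≤m
    where
    a≤m = proj₂ (Equivalence.to (parts a) (here refl))
    m∈  = Equivalence.from (parts m)
            (≤-trans (proj₁ (Equivalence.to (parts a) (here refl))) a≤m , ≤-refl)

module _ {l y} (parts : ∀ j → j ∈ suc l ∷ y ⇔ (1 ≤ j × j ≤ suc l)) where

  parts-repeat : suc l ∈ y → ∀ j → j ∈ y ⇔ (1 ≤ j × j ≤ suc l)
  parts-repeat l+1∈y j = mk⇔ (Equivalence.to (parts j) ∘ there) (absorb ∘ Equivalence.from (parts j))
    where
    absorb : j ∈ suc l ∷ y → j ∈ y
    absorb (here refl) = l+1∈y
    absorb (there j∈y) = j∈y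

  parts-fresh : suc l ∉ y → ∀ j → j ∈ y ⇔ (1 ≤ j × j ≤ l)
  parts-fresh l+1∉y j = mk⇔ to from
    where
    to : j ∈ y → 1 ≤ j × j ≤ l
    to j∈y with Equivalence.to (parts j) (there j∈y)
    ... | 1≤j , j≤1+l = 1≤j , ≤-pred (≤∧≢⇒< j≤1+l λ { refl → l+1∉y j∈y })
    from : 1 ≤ j × j ≤ l → j ∈ y
    from (1≤j , j≤l) with Equivalence.from (parts j) (1≤j , m≤n⇒m≤1+n j≤l)
    ... | here refl = contradiction j≤l (n≮n l)
    ... | there j∈y = j∈y

Gapless-from : ∀ {m x} → Linked _≥_ x → (∀ j → j ∈ x ⇔ (1 ≤ j × j ≤ m)) → Gapless m x
Gapless-from {zero}  {[]}    _  _     = empty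
Gapless-from {suc m} {[]}    _  parts =
  contradiction (Equivalence.from (parts (suc m)) (s≤s z≤n , ≤-refl)) λ ()
Gapless-from {m}     {a ∷ y} lk parts
  with head-is-max lk parts | proj₁ (Equivalence.to (parts a) (here refl))
... | refl | s≤s z≤n with a ∈? y
...   | yes a∈y = repeat (Gapless-from (Linked.tail lk) (parts-repeat parts a∈y))
...   | no  a∉y = fresh  (Gapless-from (Linked.tail lk) (parts-fresh parts a∉y))

mutual
  gapless : ℕ → ℕ → List (List ℕ)
  gapless zero    zero    = [ [] ]
  gapless zero    (suc n) = []
  gapless (suc l)         = delayedFix _++_ (λ _ → []) [] l (gaplessTop l)

  gaplessTop : ℕ → ℕ → List (List ℕ) → List (List ℕ)
  gaplessTop l m xs = map (suc l ∷_) (gapless l m ++ xs)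

gapless-unfold : ∀ l n →
  gapless (suc l) n ≡ delay [] (suc l) (λ m → gaplessTop l m (gapless (suc l) m)) n
gapless-unfold l = delayedFix-unfold _++_ (λ _ → []) [] l (gaplessTop l)

gapless-∈-top : ∀ l y → y ∈ gapless l (sum y) ++ gapless (suc l) (sum y) →
                suc l ∷ y ∈ gapless (suc l) (suc l + sum y)
gapless-∈-top l y y∈ = subst (suc l ∷ y ∈_) (sym (gapless-unfold l (suc l + sum y)))
  (∈-delay⁺ (suc l) (sum y) (λ m → gaplessTop l m (gapless (suc l) m)) (∈-map⁺ (suc l ∷_) y∈))

gapless-sound : ∀ l n {x} → x ∈ gapless l n → Gapless l x × sum x ≡ n
gapless-sound zero    zero (here refl) = empty , refl
gapless-sound (suc l) = delayedFix-ind _++_ (λ _ → []) [] l (gaplessTop l)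
  (λ n xs → ∀ {x} → x ∈ xs → Gapless (suc l) x × sum x ≡ n) step
  where
  step : ∀ n → (∀ m → m < n → ∀ {x} → x ∈ gapless (suc l) m → Gapless (suc l) x × sum x ≡ m) →
         ∀ {x} → x ∈ delay [] (suc l) (λ m → gaplessTop l m (gapless (suc l) m)) n →
         Gapless (suc l) x × sum x ≡ n
  step n ih x∈ with ∈-delay⁻ (suc l) n _ x∈
  ... | m , 1+l+m≡n , x∈′ with ∈-map⁻ (suc l ∷_) x∈′
  ... | y , y∈ , refl with ∈-++⁻ (gapless l m) y∈
  ...   | inj₁ y∈₁ = let g , Σy≡m = gapless-sound l m y∈₁
                     in fresh g , trans (cong (suc l +_) Σy≡m) 1+l+m≡n
  ...   | inj₂ y∈₂ = let g , Σy≡m = ih m (suc+≡⇒< 1+l+m≡n) y∈₂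
                     in repeat g , trans (cong (suc l +_) Σy≡m) 1+l+m≡n

gapless-complete : ∀ {l x} → Gapless l x → x ∈ gapless l (sum x)
gapless-complete empty = here refl
gapless-complete {suc l} (fresh {x = y} g)  = gapless-∈-top l y (∈-++⁺ˡ (gapless-complete g))
gapless-complete {suc l} (repeat {x = y} g) =
  gapless-∈-top l y (∈-++⁺ʳ (gapless l (sum y)) (gapless-complete g))

gapless-unique : ∀ l n → Unique (gapless l n)
gapless-unique zero    zero    = [] AllPairs.∷ AllPairs.[]
gapless-unique zero    (suc n) = AllPairs.[]
gapless-unique (suc l) = delayedFix-ind _++_ (λ _ → []) [] l (gaplessTop l) (λ _ → Unique) λ n ih →
  delay-preserves Unique AllPairs.[] (suc l) n λ m 1+l+m≡n →
    map-∷-unique (suc l) (Unique.++⁺ (gapless-unique l m) (ih m (suc+≡⇒< 1+l+m≡n))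
      λ (x∈₁ , x∈₂) → 1+n≢n (trans (sym (Gapless-ℓ (proj₁ (gapless-sound (suc l) m x∈₂))))
                                   (Gapless-ℓ (proj₁ (gapless-sound l m x∈₁)))))

pstarUpTo : ℕ → ℕ → List (List ℕ)
pstarUpTo zero    n = []
pstarUpTo (suc L) n = pstarUpTo L n ++ gapless (suc L) n

pstarUpTo-sound : ∀ L n {x} → x ∈ pstarUpTo L n → ∃[ l ] l < L × Gapless (suc l) x × sum x ≡ n
pstarUpTo-sound (suc L) n x∈ with ∈-++⁻ (pstarUpTo L n) x∈
... | inj₁ x∈₁ = let l , l<L , rest = pstarUpTo-sound L n x∈₁ in l , m≤n⇒m≤1+n l<L , rest
... | inj₂ x∈₂ = L , ≤-refl , gapless-sound (suc L) n x∈₂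

pstarUpTo-complete : ∀ L {l x} → Gapless (suc l) x → l < L → x ∈ pstarUpTo L (sum x)
pstarUpTo-complete (suc L) g l<1+L with m≤n⇒m<n∨m≡n (≤-pred l<1+L)
... | inj₁ l<L  = ∈-++⁺ˡ (pstarUpTo-complete L g l<L)
... | inj₂ refl = ∈-++⁺ʳ (pstarUpTo L _) (gapless-complete g)

pstarUpTo-unique : ∀ L n → Unique (pstarUpTo L n)
pstarUpTo-unique zero    n = AllPairs.[]
pstarUpTo-unique (suc L) n = Unique.++⁺ (pstarUpTo-unique L n) (gapless-unique (suc L) n)
  λ (x∈₁ , x∈₂) → let l , l<L , g , _ = pstarUpTo-sound L n x∈₁
                  in <⇒≢ l<L (suc-injective (trans (sym (Gapless-ℓ g))
                                                   (Gapless-ℓ (proj₁ (gapless-sound (suc L) n x∈₂)))))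

Gapless-top≤sum : ∀ {l x} → Gapless (suc l) x → suc l ≤ sum x
Gapless-top≤sum (fresh {l} {y} _)  = m≤m+n (suc l) (sum y)
Gapless-top≤sum (repeat {l} {y} _) = m≤m+n (suc l) (sum y)

pstar-enumerates : ∀ n → 1 ≤ n → Enumerates (IsPStar n) (pstarUpTo n n)
pstar-enumerates n 1≤n = record
  { unique   = pstarUpTo-unique n n
  ; sound    = λ x∈ → let _ , _ , g , Σx≡n = pstarUpTo-sound n n x∈
                      in subst (λ t → IsPStar t _) Σx≡n (Gapless⇒IsPStar g)
  ; complete = complete
  }
  where
  via-Gapless : ∀ {m x} → Gapless m x → sum x ≡ n → x ∈ pstarUpTo (sum x) (sum x)
  via-Gapless empty        Σ≡n = contradiction (subst (1 ≤_) (sym Σ≡n) 1≤n) λ ()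
  via-Gapless g@(fresh _)  _   = pstarUpTo-complete _ g (Gapless-top≤sum g)
  via-Gapless g@(repeat _) _   = pstarUpTo-complete _ g (Gapless-top≤sum g)

  complete : ∀ {x} → IsPStar n x → x ∈ pstarUpTo n n
  complete {x} pstar =
    subst (λ t → x ∈ pstarUpTo t t) total (via-Gapless (Gapless-from nonincr parts) total)
    where
    open IsPStar pstar
    open IsPartition partition

-- ω-weighted generating functions

ν-here : ∀ k y → ν (k ∷ y) k ≡ suc (ν y k)
ν-here k y = cong length (filter-accept (k ≟_) refl)

ν-there : ∀ {i k} y → i ≢ k → ν (k ∷ y) i ≡ ν y i
ν-there {i} y i≢k = cong length (filter-reject (i ≟_) i≢k)

Gapless-ν-above : ∀ {l y} → Gapless l y → ν y (suc l) ≡ 0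
Gapless-ν-above g =
  cong length (filter-none (_ ≟_) (All.map (λ j≤l → <⇒≢ (s≤s j≤l) ∘ sym) (Gapless-≤ g)))

Gapless-ν-top : ∀ {l y} → Gapless (suc l) y → ∃[ d ] ν y (suc l) ≡ suc d
Gapless-ν-top (fresh {l} {z} _)  = ν z (suc l) , ν-here (suc l) z
Gapless-ν-top (repeat {l} {z} _) = ν z (suc l) , ν-here (suc l) z

oddProduct : ℕ → List ℕ → ℕ
oddProduct zero    x = 1
oddProduct (suc l) x = oddProduct l x * (2 * ν x (suc l) ∸ 1)

oddProduct-∷ : ∀ l {k} y → l < k → oddProduct l (k ∷ y) ≡ oddProduct l y
oddProduct-∷ zero    y _   = refl
oddProduct-∷ (suc l) y l<k = cong₂ _*_ (oddProduct-∷ l y (<-trans (n<1+n l) l<k))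
                                       (cong (λ c → 2 * c ∸ 1) (ν-there y (<⇒≢ l<k)))

oddProduct-upTo : ∀ l x →
  product (map (λ i → 2 * ν x i ∸ 1) (map suc (upTo l))) ≡ oddProduct l x
oddProduct-upTo zero    x = refl
oddProduct-upTo (suc l) x = begin
  product (map f (map suc (upTo (suc l))))
    ≡⟨ cong (product ∘ map f ∘ map suc) (upTo-∷ʳ l) ⟨
  product (map f (map suc (upTo l ∷ʳ l)))
    ≡⟨ cong (product ∘ map f) (map-++ suc (upTo l) [ l ]) ⟩
  product (map f (map suc (upTo l) ∷ʳ suc l))
    ≡⟨ cong product (map-++ f (map suc (upTo l)) [ suc l ]) ⟩
  product (map f (map suc (upTo l)) ∷ʳ f (suc l))
    ≡⟨ product-++ (map f (map suc (upTo l))) [ f (suc l) ] ⟩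
  product (map f (map suc (upTo l))) * (f (suc l) * 1)
    ≡⟨ cong₂ _*_ (oddProduct-upTo l x) (*-identityʳ _) ⟩
  oddProduct (suc l) x ∎
  where
  open ≡-Reasoning
  f = λ i → 2 * ν x i ∸ 1

ω-Gapless : ∀ {l x} → Gapless (suc l) x → ω x ≡ ν x (suc l) * oddProduct l x
ω-Gapless {l} {x} g rewrite Gapless-ℓ g = cong (ν x (suc l) *_) (oddProduct-upTo l x)

odd-step : ∀ a d → a * (2 * suc (suc d) ∸ 1) ≡ a * (2 * suc d ∸ 1) + (a + a)
odd-step = lemma
  where
  -- the truncated subtractions are already evaluated here, so the ring solver applies
  lemma : ∀ a d → a * (suc d + (suc (suc d) + 0)) ≡ a * (d + (suc d + 0)) + (a + a)
  lemma = solve-∀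

weightSum : (List ℕ → ℕ) → ℕ → Series
weightSum w l n = sum (map w (gapless l n))

weightSum-+ : ∀ u v l → weightSum (λ x → u x + v x) l ≗ weightSum u l ⊕ weightSum v l
weightSum-+ u v l n = sum-map-+ u v (gapless l n)

weightSum-suc : ∀ {l} w u v →
  (∀ {y} → Gapless l y → w (suc l ∷ y) ≡ u y) →
  (∀ {y} → Gapless (suc l) y → w (suc l ∷ y) ≡ v y) →
  weightSum w (suc l) ≗ shift (suc l) (weightSum u l ⊕ weightSum v (suc l))
weightSum-suc {l} w u v w≡u w≡v n = begin
  sum (map w (gapless (suc l) n))
    ≡⟨ cong (sum ∘ map w) (gapless-unfold l n) ⟩
  sum (map w (delay [] (suc l) (λ m → gaplessTop l m (gapless (suc l) m)) n))
    ≡⟨ delay-natural (sum ∘ map w) (suc l) _ n ⟩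
  shift (suc l) (λ m → sum (map w (gaplessTop l m (gapless (suc l) m)))) n
    ≡⟨ delay-cong (suc l) top n ⟩
  shift (suc l) (weightSum u l ⊕ weightSum v (suc l)) n ∎
  where
  open ≡-Reasoning
  top : ∀ m → sum (map w (gaplessTop l m (gapless (suc l) m))) ≡ weightSum u l m + weightSum v (suc l) m
  top m = begin
    sum (map w (map (suc l ∷_) (gapless l m ++ gapless (suc l) m)))
      ≡⟨ cong sum (map-∘ (gapless l m ++ _)) ⟨
    sum (map (w ∘ (suc l ∷_)) (gapless l m ++ gapless (suc l) m))
      ≡⟨ sum-map-++ (w ∘ (suc l ∷_)) (gapless l m) _ ⟩
    sum (map (w ∘ (suc l ∷_)) (gapless l m)) + sum (map (w ∘ (suc l ∷_)) (gapless (suc l) m))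
      ≡⟨ cong₂ _+_ (sum-map-cong (All.tabulate (w≡u ∘ proj₁ ∘ gapless-sound l m)))
                   (sum-map-cong (All.tabulate (w≡v ∘ proj₁ ∘ gapless-sound (suc l) m))) ⟩
    weightSum u l m + weightSum v (suc l) m ∎

W W⁺ ωSum : ℕ → Series
W l    = weightSum (oddProduct l) l
W⁺ l   = weightSum (oddProduct l) (suc l)
ωSum l = weightSum ω (suc l)

W⁺-rec : ∀ l → W⁺ l ≗ shift (suc l) (W l ⊕ W⁺ l)
W⁺-rec l = weightSum-suc (oddProduct l) (oddProduct l) (oddProduct l)
  (λ {y} _ → oddProduct-∷ l y ≤-refl) (λ {y} _ → oddProduct-∷ l y ≤-refl)

W-rec : ∀ l → W (suc l) ≗ shift (suc l) (W l ⊕ (W (suc l) ⊕ (W⁺ l ⊕ W⁺ l)))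
W-rec l = ≗.trans (weightSum-suc (oddProduct (suc l)) (oddProduct l) (λ y → a y + (b y + b y)) fresh-step repeat-step)
  (delay-cong (suc l) (⊕-congˡ (W l) (≗.trans (weightSum-+ a (λ y → b y + b y) (suc l))
                                               (⊕-congˡ (W (suc l)) (weightSum-+ b b (suc l))))))
  where
  open ≡-Reasoning
  a = oddProduct (suc l)
  b = oddProduct l
  fresh-step : ∀ {y} → Gapless l y → a (suc l ∷ y) ≡ b y
  fresh-step {y} g = begin
    b (suc l ∷ y) * (2 * ν (suc l ∷ y) (suc l) ∸ 1) ≡⟨ cong₂ _*_ (oddProduct-∷ l y ≤-refl)
      (cong (λ c → 2 * c ∸ 1) (trans (ν-here (suc l) y) (cong suc (Gapless-ν-above g)))) ⟩
    b y * 1                                         ≡⟨ *-identityʳ (b y) ⟩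
    b y                                             ∎
  repeat-step : ∀ {y} → Gapless (suc l) y → a (suc l ∷ y) ≡ a y + (b y + b y)
  repeat-step {y} g with Gapless-ν-top g
  ... | d , ν≡1+d = begin
    b (suc l ∷ y) * (2 * ν (suc l ∷ y) (suc l) ∸ 1) ≡⟨ cong₂ _*_ (oddProduct-∷ l y ≤-refl)
      (cong (λ c → 2 * c ∸ 1) (trans (ν-here (suc l) y) (cong suc ν≡1+d))) ⟩
    b y * (2 * suc (suc d) ∸ 1)                     ≡⟨ odd-step (b y) d ⟩
    b y * (2 * suc d ∸ 1) + (b y + b y)
      ≡⟨ cong (λ c → b y * (2 * c ∸ 1) + (b y + b y)) ν≡1+d ⟨
    a y + (b y + b y)                               ∎

ωSum-rec : ∀ l → ωSum l ≗ shift (suc l) (W l ⊕ (W⁺ l ⊕ ωSum l))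
ωSum-rec l = ≗.trans (weightSum-suc ω (oddProduct l) (λ y → oddProduct l y + ω y) fresh-step repeat-step)
  (delay-cong (suc l) (⊕-congˡ (W l) (weightSum-+ (oddProduct l) ω (suc l))))
  where
  open ≡-Reasoning
  ω-top : ∀ {y} → Gapless (suc l) (suc l ∷ y) → ω (suc l ∷ y) ≡ suc (ν y (suc l)) * oddProduct l y
  ω-top {y} g = trans (ω-Gapless g) (cong₂ _*_ (ν-here (suc l) y) (oddProduct-∷ l y ≤-refl))
  fresh-step : ∀ {y} → Gapless l y → ω (suc l ∷ y) ≡ oddProduct l y
  fresh-step {y} g = begin
    ω (suc l ∷ y)                         ≡⟨ ω-top (fresh g) ⟩
    suc (ν y (suc l)) * oddProduct l y    ≡⟨ cong (λ c → suc c * oddProduct l y) (Gapless-ν-above g) ⟩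
    oddProduct l y + 0                    ≡⟨ +-identityʳ (oddProduct l y) ⟩
    oddProduct l y                        ∎
  repeat-step : ∀ {y} → Gapless (suc l) y → ω (suc l ∷ y) ≡ oddProduct l y + ω y
  repeat-step {y} g = trans (ω-top (repeat g)) (cong (oddProduct l y +_) (sym (ω-Gapless g)))

W⁺-closed : ∀ l → W⁺ l ≗ shift (suc l) (geom l (W l))
W⁺-closed l = ≗.trans
  (geom-unique l (shift (suc l) (W l)) (≗.trans (W⁺-rec l) (shift-⊕ (suc l) (W l) (W⁺ l))))
  (≗.sym (geom-commute (shift-linear (suc l)) l (W l)))

W-suc-closed : ∀ l → W (suc l) ≗ geom l (plusShift (suc l) (W⁺ l))
W-suc-closed l = geom-unique l (plusShift (suc l) Y) (begin
  W (suc l)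
    ≈⟨ W-rec l ⟩
  shift (suc l) (X ⊕ (W (suc l) ⊕ (Y ⊕ Y)))
    ≈⟨ delay-cong (suc l) rearrange ⟩
  shift (suc l) (((X ⊕ Y) ⊕ Y) ⊕ W (suc l))
    ≈⟨ shift-⊕ (suc l) _ _ ⟩
  shift (suc l) ((X ⊕ Y) ⊕ Y) ⊕ shift (suc l) (W (suc l))
    ≈⟨ ⊕-congʳ _ (shift-⊕ (suc l) (X ⊕ Y) Y) ⟩
  (shift (suc l) (X ⊕ Y) ⊕ shift (suc l) Y) ⊕ shift (suc l) (W (suc l))
    ≈⟨ ⊕-congʳ _ (⊕-congʳ (shift (suc l) Y) (W⁺-rec l)) ⟨
  plusShift (suc l) Y ⊕ shift (suc l) (W (suc l)) ∎)
  where
  open ≗-Reasoning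
  X = W l
  Y = W⁺ l
  rearrange : X ⊕ (W (suc l) ⊕ (Y ⊕ Y)) ≗ ((X ⊕ Y) ⊕ Y) ⊕ W (suc l)
  rearrange = begin
    X ⊕ (W (suc l) ⊕ (Y ⊕ Y)) ≈⟨ ⊕-congˡ X (⊕-comm (W (suc l)) (Y ⊕ Y)) ⟩
    X ⊕ ((Y ⊕ Y) ⊕ W (suc l)) ≈⟨ ⊕-assoc X (Y ⊕ Y) _ ⟨
    (X ⊕ (Y ⊕ Y)) ⊕ W (suc l) ≈⟨ ⊕-congʳ (W (suc l)) (⊕-assoc X Y Y) ⟨
    ((X ⊕ Y) ⊕ Y) ⊕ W (suc l) ∎

ωSum-closed : ∀ l → ωSum l ≗ geom l (W⁺ l)
ωSum-closed l = geom-unique l (W⁺ l) (begin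
  ωSum l
    ≈⟨ ωSum-rec l ⟩
  shift (suc l) (W l ⊕ (W⁺ l ⊕ ωSum l))
    ≈⟨ delay-cong (suc l) (⊕-assoc (W l) (W⁺ l) (ωSum l)) ⟨
  shift (suc l) ((W l ⊕ W⁺ l) ⊕ ωSum l)
    ≈⟨ shift-⊕ (suc l) _ _ ⟩
  shift (suc l) (W l ⊕ W⁺ l) ⊕ shift (suc l) (ωSum l)
    ≈⟨ ⊕-congʳ _ (W⁺-rec l) ⟨
  W⁺ l ⊕ shift (suc l) (ωSum l) ∎)
  where open ≗-Reasoning

W⁺-double : ∀ l → W⁺ l ⊕ W⁺ l ≗ shift (suc l) (geom l (W l ⊕ W l))
W⁺-double l = ≗.trans (⊕-cong (W⁺-closed l) (W⁺-closed l))
  (≗.sym (Linear.⊕-homo (∘-linear (shift-linear (suc l)) (geom-linear l)) (W l) (W l)))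

-- That is, 2 W l = q^(l(l+1)/2) (−1;q)_(l+1) / (q;q)_l².
W-double : ∀ l → geom l (W l ⊕ W l) ≗ eulerTerm l (c (suc l))
W-double zero    = Linear.≗-cong (geom-linear 0) λ { zero → refl ; (suc n) → refl }
W-double (suc l) = begin
  geom k (W k ⊕ W k)
    ≈⟨ Linear.≗-cong (geom-linear k) (⊕-cong (W-suc-closed l) (W-suc-closed l)) ⟩
  geom k (geom l (plusShift k Y) ⊕ geom l (plusShift k Y))
    ≈⟨ Linear.≗-cong (geom-linear k) (≗.sym (Linear.⊕-homo geom∘plusShift Y Y)) ⟩
  geom k (geom l (plusShift k (Y ⊕ Y)))
    ≈⟨ Linear.≗-cong (∘-linear (geom-linear k) geom∘plusShift)
         (≗.trans (W⁺-double l) (delay-cong k (W-double l))) ⟩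
  geom k (geom l (plusShift k (shift k (eulerTerm l (c k)))))
    ≈⟨ Linear.≗-cong (geom-linear k) (plusShift-commute (geom-linear l) k _) ⟩
  geom k (plusShift k (geom l (shift k (eulerTerm l (c k)))))
    ≈⟨ Linear.≗-cong (∘-linear (geom-linear k) (plusShift-linear k))
         (≗.sym (geom-commute (shift-linear k) l _)) ⟩
  geom k (plusShift k (eulerTerm k (c k)))
    ≈⟨ Linear.≗-cong (geom-linear k) (plusShift-commute (eulerTerm-linear k) k (c k)) ⟨
  geom k (eulerTerm k (plusShift k (c k)))
    ≈⟨ geom-commute (eulerTerm-linear k) k _ ⟨
  eulerTerm k (c (suc k)) ∎
  where
  open ≗-Reasoning
  k = suc l
  Y = W⁺ l
  geom∘plusShift = ∘-linear (geom-linear l) (plusShift-linear k)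

ωSum-double : ∀ l → ωSum l ⊕ ωSum l ≗ eulerTerm (suc l) (c (suc l))
ωSum-double l = begin
  ωSum l ⊕ ωSum l
    ≈⟨ ⊕-cong (ωSum-closed l) (ωSum-closed l) ⟩
  geom l (W⁺ l) ⊕ geom l (W⁺ l)
    ≈⟨ Linear.⊕-homo (geom-linear l) (W⁺ l) (W⁺ l) ⟨
  geom l (W⁺ l ⊕ W⁺ l)
    ≈⟨ Linear.≗-cong (geom-linear l) (≗.trans (W⁺-double l) (delay-cong (suc l) (W-double l))) ⟩
  geom l (shift (suc l) (eulerTerm l (c (suc l))))
    ≈⟨ geom-commute (shift-linear (suc l)) l _ ⟨
  eulerTerm (suc l) (c (suc l)) ∎
  where open ≗-Reasoning

pstarUpTo-ω-double : ∀ L n → let s = sum (map ω (pstarUpTo L n)) in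
  s + s ≡ sumBelow L (λ l → eulerTerm (suc l) (c (suc l))) n
pstarUpTo-ω-double zero    n = refl
pstarUpTo-ω-double (suc L) n = begin
  sum (map ω (pstarUpTo L n ++ gapless (suc L) n)) + sum (map ω (pstarUpTo L n ++ gapless (suc L) n))
    ≡⟨ cong₂ _+_ (sum-map-++ ω (pstarUpTo L n) _) (sum-map-++ ω (pstarUpTo L n) _) ⟩
  (s + ωSum L n) + (s + ωSum L n)         ≡⟨ +-interchange s (ωSum L n) s (ωSum L n) ⟩
  (s + s) + (ωSum L n + ωSum L n)         ≡⟨ cong₂ _+_ (pstarUpTo-ω-double L n) (ωSum-double L n) ⟩
  sumBelow L h n + h L n                  ≡⟨ sumBelow-last L h n ⟨
  sumBelow (suc L) h n                    ∎
  where
  open ≡-Reasoning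
  s = sum (map ω (pstarUpTo L n))
  h = λ l → eulerTerm (suc l) (c (suc l))

-- Overpartitions

size : List (ℕ × Bool) → ℕ
size x = sum (map proj₁ x)

-- Over≤ M x: x is an overpartition, in the list form of IsOverpartition, with parts at most M;
-- Plain M x: x is some non-overlined copies of suc M followed by an Over≤ M.
mutual
  data Over≤ : ℕ → List (ℕ × Bool) → Set where
    empty : Over≤ 0 []
    lift  : ∀ {M x} → Over≤ M x → Over≤ (suc M) x
    top   : ∀ {M x} b → Plain M x → Over≤ (suc M) ((suc M , b) ∷ x)

  data Plain : ℕ → List (ℕ × Bool) → Set where
    below : ∀ {M x} → Over≤ M x → Plain M x
    again : ∀ {M x} → Plain M x → Plain M ((suc M , false) ∷ x)

withTop : ℕ → Bool → List (List (ℕ × Bool)) → List (List (ℕ × Bool))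
withTop M b = map ((suc M , b) ∷_)

withTops : ℕ → List (List (ℕ × Bool)) → List (List (ℕ × Bool))
withTops M xs = withTop M true xs ++ withTop M false xs

mutual
  overpartitions : ℕ → ℕ → List (List (ℕ × Bool))
  overpartitions zero    zero    = [ [] ]
  overpartitions zero    (suc n) = []
  overpartitions (suc M) n = overpartitions M n ++ delay [] (suc M) (withTops M ∘ plain M) n

  plain : ℕ → ℕ → List (List (ℕ × Bool))
  plain M = delayedFix _++_ (overpartitions M) [] M (λ _ → withTop M false)

plain-unfold : ∀ M n → plain M n ≡ overpartitions M n ++ delay [] (suc M) (withTop M false ∘ plain M) n
plain-unfold M = delayedFix-unfold _++_ (overpartitions M) [] M (λ _ → withTop M false)

plain-count : ∀ M → length ∘ plain M ≗ geom M (length ∘ overpartitions M)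
plain-count M = geom-unique M (length ∘ overpartitions M) λ n → begin
  length (plain M n)
    ≡⟨ cong length (plain-unfold M n) ⟩
  length (overpartitions M n ++ delay [] (suc M) (withTop M false ∘ plain M) n)
    ≡⟨ length-++ (overpartitions M n) ⟩
  length (overpartitions M n) + length (delay [] (suc M) (withTop M false ∘ plain M) n)
    ≡⟨ cong (length (overpartitions M n) +_) (delay-natural length (suc M) _ n) ⟩
  length (overpartitions M n) + shift (suc M) (length ∘ withTop M false ∘ plain M) n
    ≡⟨ cong (length (overpartitions M n) +_) (delay-cong (suc M) (length-map _ ∘ plain M) n) ⟩
  length (overpartitions M n) + shift (suc M) (length ∘ plain M) n ∎
  where open ≡-Reasoning

overpartitions-count : ∀ M → length ∘ overpartitions M ≗ G M 0
overpartitions-count zero    zero    = refl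
overpartitions-count zero    (suc n) = refl
overpartitions-count (suc M) = begin
  length ∘ overpartitions (suc M)
    ≈⟨ split ⟩
  (length ∘ overpartitions M) ⊕ shift (suc M) (P ⊕ P)
    ≈⟨ ⊕-cong (overpartitions-count M) (delay-cong (suc M) (⊕-cong P≗Q P≗Q)) ⟩
  G M 0 ⊕ shift (suc M) (Q ⊕ Q)
    ≈⟨ ⊕-congˡ (G M 0) (delay-cong (suc M) (G-sucʳ M 0)) ⟨
  G M 0 ⊕ shift (suc M) (G M 1)
    ≈⟨ G-sucˡ M 0 ⟨
  G (suc M) 0 ∎
  where
  open ≗-Reasoning
  P = length ∘ plain M
  Q = geom (M + 0) (G M 0)
  P≗Q : P ≗ Q
  P≗Q rewrite +-identityʳ M =
    ≗.trans (plain-count M) (Linear.≗-cong (geom-linear M) (overpartitions-count M))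
  both-length : ∀ m → length (withTops M (plain M m)) ≡ P m + P m
  both-length m = trans (length-++ (withTop M true (plain M m)))
                        (cong₂ _+_ (length-map _ (plain M m)) (length-map _ (plain M m)))
  split : length ∘ overpartitions (suc M) ≗ (length ∘ overpartitions M) ⊕ shift (suc M) (P ⊕ P)
  split n = trans (length-++ (overpartitions M n)) (cong (length (overpartitions M n) +_)
    (trans (delay-natural length (suc M) _ n) (delay-cong (suc M) both-length n)))

PartsIn : ℕ → ℕ → List (ℕ × Bool) → Set
PartsIn lo hi = All (λ p → lo ≤ proj₁ p × proj₁ p ≤ hi)

mutual
  Over≤-parts : ∀ {M x} → Over≤ M x → PartsIn 1 M x
  Over≤-parts empty     = []
  Over≤-parts (lift o)  = All.map (λ (1≤a , a≤M) → 1≤a , m≤n⇒m≤1+n a≤M) (Over≤-parts o)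
  Over≤-parts (top b p) = (s≤s z≤n , ≤-refl) ∷ Plain-parts p

  Plain-parts : ∀ {M x} → Plain M x → PartsIn 1 (suc M) x
  Plain-parts (below o) = All.map (λ (1≤a , a≤M) → 1≤a , m≤n⇒m≤1+n a≤M) (Over≤-parts o)
  Plain-parts (again p) = (s≤s z≤n , ≤-refl) ∷ Plain-parts p

Over≤-top-absurd : ∀ {M b y} → ¬ Over≤ M ((suc M , b) ∷ y)
Over≤-top-absurd o with Over≤-parts o
... | (_ , 1+M≤M) ∷ _ = 1+n≰n 1+M≤M

Plain-∷ : ∀ {M y} b → Plain M y → Linked OverStep y → Linked OverStep ((suc M , b) ∷ y)
Plain-∷ b (below o) lk with Over≤-parts o
... | []               = [-]
... | (_ , c≤M) ∷ _    = (m≤n⇒m≤1+n c≤M , λ { refl → contradiction c≤M 1+n≰n }) ∷ lk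
Plain-∷ b (again p) lk = (≤-refl , λ _ → refl) ∷ lk

mutual
  Over≤-ordered : ∀ {M x} → Over≤ M x → Linked OverStep x
  Over≤-ordered empty     = []
  Over≤-ordered (lift o)  = Over≤-ordered o
  Over≤-ordered (top b p) = Plain-∷ b p (Plain-ordered p)

  Plain-ordered : ∀ {M x} → Plain M x → Linked OverStep x
  Plain-ordered (below o) = Over≤-ordered o
  Plain-ordered (again p) = Plain-∷ false p (Plain-ordered p)

PartsIn-below-head : ∀ {M a b y} → 1 ≤ a → a ≤ M → PartsIn 1 (suc M) y →
                     Linked OverStep ((a , b) ∷ y) → PartsIn 1 M ((a , b) ∷ y)
PartsIn-below-head 1≤a a≤M parts lk = (1≤a , a≤M) ∷
  All.zipWith (λ ((1≤c , _) , c≤a) → 1≤c , ≤-trans c≤a a≤M) (parts , Linked-head-bound proj₁ proj₁ lk)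

mutual
  Over≤-from : ∀ M {x} → PartsIn 1 M x → Linked OverStep x → Over≤ M x
  Over≤-from zero    {[]}    _                 _  = empty
  Over≤-from zero    {_ ∷ _} ((1≤a , a≤0) ∷ _) _  = contradiction (≤-trans 1≤a a≤0) λ ()
  Over≤-from (suc M) {[]}    _                 _  = lift (Over≤-from M [] [])
  Over≤-from (suc M) {(a , b) ∷ y} ((1≤a , a≤1+M) ∷ parts) lk with a ≟ suc M
  ... | yes refl  = top b (Plain-from M parts lk)
  ... | no a≢1+M =
    lift (Over≤-from M (PartsIn-below-head 1≤a (≤-pred (≤∧≢⇒< a≤1+M a≢1+M)) parts lk) lk)

  Plain-from : ∀ M {b y} → PartsIn 1 (suc M) y → Linked OverStep ((suc M , b) ∷ y) → Plain M y
  Plain-from M {y = []} _ _ = below (Over≤-from M [] [])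
  Plain-from M {y = (c , d) ∷ z} ((1≤c , c≤1+M) ∷ parts) ((_ , plain-if-equal) ∷ lk) with c ≟ suc M
  ... | yes refl rewrite plain-if-equal refl = again (Plain-from M parts lk)
  ... | no c≢1+M =
    below (Over≤-from M (PartsIn-below-head 1≤c (≤-pred (≤∧≢⇒< c≤1+M c≢1+M)) parts lk) lk)

∈-withTop⁻ : ∀ {M b xs x} → x ∈ withTop M b xs → ∃[ y ] x ≡ (suc M , b) ∷ y × y ∈ xs
∈-withTop⁻ x∈ with ∈-map⁻ _ x∈
... | y , y∈ , refl = y , refl , y∈

∈-withTops⁻ : ∀ {M xs x} → x ∈ withTops M xs →
              ∃[ b ] ∃[ y ] x ≡ (suc M , b) ∷ y × y ∈ xs
∈-withTops⁻ {M} {xs} x∈ with ∈-++⁻ (withTop M true xs) x∈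
... | inj₁ x∈t = true  , ∈-withTop⁻ x∈t
... | inj₂ x∈f = false , ∈-withTop⁻ x∈f

mutual
  overpartitions-sound : ∀ M n {x} → x ∈ overpartitions M n → Over≤ M x × size x ≡ n
  overpartitions-sound zero    zero (here refl) = empty , refl
  overpartitions-sound (suc M) n x∈ with ∈-++⁻ (overpartitions M n) x∈
  ... | inj₁ x∈₁ = let o , size≡n = overpartitions-sound M n x∈₁ in lift o , size≡n
  ... | inj₂ x∈₂ with ∈-delay⁻ (suc M) n _ x∈₂
  ...   | m , 1+M+m≡n , x∈′ with ∈-withTops⁻ {M} {plain M m} x∈′
  ...     | b , y , refl , y∈ = let p , size≡m = plain-sound M m y∈
                                in top b p , trans (cong (suc M +_) size≡m) 1+M+m≡n

  plain-sound : ∀ M n {x} → x ∈ plain M n → Plain M x × size x ≡ n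
  plain-sound M = delayedFix-ind _++_ (overpartitions M) [] M (λ _ → withTop M false)
    (λ n xs → ∀ {x} → x ∈ xs → Plain M x × size x ≡ n) step
    where
    step : ∀ n → (∀ m → m < n → ∀ {x} → x ∈ plain M m → Plain M x × size x ≡ m) →
           ∀ {x} → x ∈ overpartitions M n ++ delay [] (suc M) (withTop M false ∘ plain M) n →
           Plain M x × size x ≡ n
    step n ih x∈ with ∈-++⁻ (overpartitions M n) x∈
    ... | inj₁ x∈₁ = let o , size≡n = overpartitions-sound M n x∈₁ in below o , size≡n
    ... | inj₂ x∈₂ with ∈-delay⁻ (suc M) n _ x∈₂
    ...   | m , 1+M+m≡n , x∈′ with ∈-withTop⁻ {M} {false} {plain M m} x∈′
    ...     | y , refl , y∈ = let p , size≡m = ih m (suc+≡⇒< 1+M+m≡n) y∈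
                              in again p , trans (cong (suc M +_) size≡m) 1+M+m≡n

mutual
  overpartitions-complete : ∀ {M x} → Over≤ M x → x ∈ overpartitions M (size x)
  overpartitions-complete empty    = here refl
  overpartitions-complete (lift o) = ∈-++⁺ˡ (overpartitions-complete o)
  overpartitions-complete {suc M} (top {x = y} b p) = ∈-++⁺ʳ (overpartitions M _)
    (∈-delay⁺ (suc M) (size y) _ (into b (∈-map⁺ _ (plain-complete p))))
    where
    into : ∀ b → (suc M , b) ∷ y ∈ withTop M b (plain M (size y)) →
           (suc M , b) ∷ y ∈ withTops M (plain M (size y))
    into true  = ∈-++⁺ˡ
    into false = ∈-++⁺ʳ _

  plain-complete : ∀ {M x} → Plain M x → x ∈ plain M (size x)
  plain-complete {M} {x} (below o) =
    subst (x ∈_) (sym (plain-unfold M (size x))) (∈-++⁺ˡ (overpartitions-complete o))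
  plain-complete {M} (again {x = y} p) =
    subst ((suc M , false) ∷ y ∈_) (sym (plain-unfold M (suc M + size y)))
      (∈-++⁺ʳ (overpartitions M _)
        (∈-delay⁺ (suc M) (size y) (withTop M false ∘ plain M) (∈-map⁺ _ (plain-complete p))))

mutual
  overpartitions-unique : ∀ M n → Unique (overpartitions M n)
  overpartitions-unique zero    zero    = [] AllPairs.∷ AllPairs.[]
  overpartitions-unique zero    (suc n) = AllPairs.[]
  overpartitions-unique (suc M) n = Unique.++⁺ (overpartitions-unique M n)
    (delay-preserves Unique AllPairs.[] (suc M) n λ m _ →
      Unique.++⁺ (map-∷-unique _ (plain-unique M m)) (map-∷-unique _ (plain-unique M m)) true≢false)
    λ (x∈₁ , x∈₂) → not-top (proj₁ (overpartitions-sound M n x∈₁)) x∈₂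
    where
    true≢false : ∀ {m x} → ¬ (x ∈ withTop M true (plain M m) × x ∈ withTop M false (plain M m))
    true≢false {m} (x∈t , x∈f) with ∈-withTop⁻ {M} {true} {plain M m} x∈t
                                  | ∈-withTop⁻ {M} {false} {plain M m} x∈f
    ... | _ , refl , _ | _ , () , _
    not-top : ∀ {x} → Over≤ M x →
              ¬ x ∈ delay [] (suc M) (withTops M ∘ plain M) n
    not-top o x∈ with ∈-delay⁻ (suc M) n _ x∈
    ... | m , _ , x∈′ with ∈-withTops⁻ {M} {plain M m} x∈′
    ...   | _ , _ , refl , _ = Over≤-top-absurd o

  plain-unique : ∀ M n → Unique (plain M n)
  plain-unique M = delayedFix-ind _++_ (overpartitions M) [] M (λ _ → withTop M false) (λ _ → Unique)
    λ n ih → Unique.++⁺ (overpartitions-unique M n)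
      (delay-preserves Unique AllPairs.[] (suc M) n λ m 1+M+m≡n →
        map-∷-unique _ (ih m (suc+≡⇒< 1+M+m≡n)))
      λ (x∈₁ , x∈₂) → not-top n (proj₁ (overpartitions-sound M n x∈₁)) x∈₂
    where
    not-top : ∀ n {x} → Over≤ M x → ¬ x ∈ delay [] (suc M) (withTop M false ∘ plain M) n
    not-top n o x∈ with ∈-delay⁻ (suc M) n _ x∈
    ... | m , _ , x∈′ with ∈-withTop⁻ {M} {false} {plain M m} x∈′
    ...   | _ , refl , _ = Over≤-top-absurd o

parts≤size : ∀ x → All (λ p → proj₁ p ≤ size x) x
parts≤size []             = []
parts≤size ((a , b) ∷ x) =
  m≤m+n a (size x) ∷ All.map (λ c≤Σ → ≤-trans c≤Σ (m≤n+m (size x) a)) (parts≤size x)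

overpartitions-enumerates : ∀ n → Enumerates (IsOverpartition n) (overpartitions n n)
overpartitions-enumerates n = record
  { unique   = overpartitions-unique n n
  ; sound    = λ x∈ → let o , size≡n = overpartitions-sound n n x∈ in record
      { positive = All.map proj₁ (Over≤-parts o) ; ordered = Over≤-ordered o ; total = size≡n }
  ; complete = complete
  }
  where
  complete : ∀ {x} → IsOverpartition n x → x ∈ overpartitions n n
  complete {x} over = subst (λ t → x ∈ overpartitions t t) total
    (overpartitions-complete (Over≤-from (size x) (All.zip (positive , parts≤size x)) ordered))
    where open IsOverpartition over

proposition2p7 : (n : ℕ) → 1 ≤ n →
    (L : List (List (ℕ × Bool))) → Enumerates (IsOverpartition n) L →
    (M : List (List ℕ)) → Enumerates (IsPStar n) M →
    length L ≡ 2 * sum (map ω M)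
proposition2p7 n@(suc n′) 1≤n L L-enum M M-enum = begin
  length L
    ≡⟨ ↭-length (Enumerates-↭ L-enum (overpartitions-enumerates n)) ⟩
  length (overpartitions n n)
    ≡⟨ overpartitions-count n n ⟩
  G n 0 n
    ≡⟨ overpartitionGF-eulerTerms n′ ⟩
  sumBelow n (λ l → eulerTerm (suc l) (c (suc l))) n
    ≡⟨ pstarUpTo-ω-double n n ⟨
  sum (map ω (pstarUpTo n n)) + sum (map ω (pstarUpTo n n))
    ≡⟨ cong (λ s → s + s) (sum-↭ (map⁺ ω (Enumerates-↭ (pstar-enumerates n 1≤n) M-enum))) ⟩
  sum (map ω M) + sum (map ω M)
    ≡⟨ cong (sum (map ω M) +_) (+-identityʳ (sum (map ω M))) ⟨
  2 * sum (map ω M) ∎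
  where open ≡-Reasoning
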